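{- Let $P_1=\{p_1,\dots,p_s\}$, $P_2=\{p_{s+1},\dots,p_d\}$, $Q_1=\{q_1,\dots,q_s\}$, $Q_2=\{q_{s+1},\dots,q_d\}$ be finite posets (all underlying sets pairwise disjoint). Then $$N(\Gamma(P_1\oplus P_2,\,Q_1\oplus Q_2))=N(\Gamma(P_1,Q_1))\cdot N(\Gamma(P_2,Q_2)).$$ In particular, if $N(\Gamma(P_1,Q_1))\le 6^{s/2}$ and $N(\Gamma(P_2,Q_2))\le 6^{(d-s)/2}$, then $N(\Gamma(P_1\oplus P_2,Q_1\oplus Q_2))\le 6^{d/2}$.
   Context: For a finite poset $P=\{p_1,\dots,p_m\}$ (elements indexed by an index set $I$ of size $m$), an antichain is a set of pairwise incomparable elements (including $\emptyset$); for an antichain $A$ put $\rho(A)=\sum_{p_i\in A}\mathbf e_i\in\mathbb R^{I}$. The chain polytope is $\mathcal C(P)=\mathrm{conv}\{\rho(A): A \text{ antichain}\}$. For posets $P=\{p_i\}_{i\in I}$ and $Q=\{q_i\}_{i\in I}$ indexed by the same index set (coordinate $i$ corresponding to $p_i$ and $q_i$), $\Gamma(P,Q)=\mathrm{conv}(\mathcal C(P)\cup(-\mathcal C(Q)))\subset\mathbb R^I$. Here $P_1\oplus P_2$ is indexed by $\{1,\dots,d\}$, as is $Q_1\oplus Q_2$. $N(\mathcal P)$ is the number of facets of $\mathcal P$. The ordinal sum $P\oplus Q$ of posets on disjoint sets is the poset on $P\cup Q$ with $s\le t$ iff ($s,t\in P$, $s\le_P t$) or ($s,t\in Q$, $s\le_Q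 t$) or ($s\in P$, $t\in Q$). -}

module Defs where

open import Data.Nat as ℕ using (ℕ; zero; suc)
open import Data.Fin using (Fin; zero; suc; splitAt)
open import Data.Bool using (Bool; true; false; if_then_else_)
open import Data.Sum using (_⊎_; inj₁; inj₂)
open import Data.Product using (Σ; ∃; _×_; _,_)
open import Data.Unit using (⊤)
open import Data.Empty using (⊥)
open import Data.Rational using (ℚ; 0ℚ; 1ℚ; _+_; _*_; -_; _≤_; _<_)
open import Relation.Nullary using (¬_)
open import Relation.Binary.PropositionalEquality using (_≡_; _≢_)

-- A (binary) relation on the index set Fin n; a finite poset on
-- {p_1,...,p_n} is such a relation that is a partial order (w.r.t. _≡_).
Rel : ℕ → Set₁
Rel n = Fin n → Fin n → Set

Vec : ℕ → Set
Vec n = Fin n → ℚ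

sumFin : (n : ℕ) → (Fin n → ℚ) → ℚ
sumFin zero    f = 0ℚ
sumFin (suc n) f = f zero + sumFin n (λ i → f (suc i))

_·_ : {n : ℕ} → Vec n → Vec n → ℚ
_·_ {n} a x = sumFin n (λ i → a i * x i)

_≗v_ : {n : ℕ} → Vec n → Vec n → Set
x ≗v y = ∀ i → x i ≡ y i

IsAntichain : {n : ℕ} → Rel n → (Fin n → Bool) → Set
IsAntichain R A = ∀ i j → A i ≡ true → A j ≡ true → i ≢ j → ¬ R i j

ρ : {n : ℕ} → (Fin n → Bool) → Vec n
ρ A i = if A i then 1ℚ else 0ℚ

-- The generating point set of Γ(P,Q) = conv(C(P) ∪ (−C(Q))):
-- all ρ(A) for antichains A of P and all −ρ(B) for antichains B of Q.
ΓGen : {n : ℕ} → Rel n → Rel n → Vec n → Set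
ΓGen P Q x =
  (∃ λ A → IsAntichain P A × (x ≗v ρ A)) ⊎
  (∃ λ B → IsAntichain Q B × (x ≗v (λ i → - ρ B i)))

AffinelyIndependent : {n : ℕ} → (Fin n → Vec n) → Set
AffinelyIndependent {n} w =
  (c : Fin n → ℚ) →
  sumFin n c ≡ 0ℚ →
  (∀ i → sumFin n (λ j → c j * w j i) ≡ 0ℚ) →
  ∀ j → c j ≡ 0ℚ

-- (a , b) defines a facet of conv(V) ⊂ ℚ^n: a ≠ 0, a·x ≤ b is valid on V,
-- and the hyperplane a·x = b contains n affinely independent points of V
-- (i.e. its intersection with conv(V) has dimension n − 1).
IsFacetIneq : {n : ℕ} → (Vec n → Set) → Vec n → ℚ → Set
IsFacetIneq {n} V a b =
  (∃ λ i → a i ≢ 0ℚ) ×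
  (∀ x → V x → a · x ≤ b) ×
  (∃ λ (w : Fin n → Vec n) →
     (∀ j → V (w j)) × (∀ j → a · w j ≡ b) × AffinelyIndependent w)

-- Two facet inequalities define the same facet iff they are positive
-- multiples of each other.
SameIneq : {n : ℕ} → (Vec n × ℚ) → (Vec n × ℚ) → Set
SameIneq (a , b) (a' , b') =
  ∃ λ λ' → (0ℚ < λ') × (a' ≗v (λ i → λ' * a i)) × (b' ≡ λ' * b)

-- N(conv V) = k : there is a list of k facet inequalities, pairwise
-- defining different facets, such that every facet inequality defines
-- one of these facets.
HasFacetNumber : {n : ℕ} → (Vec n → Set) → ℕ → Set
HasFacetNumber {n} V k =
  Σ (Fin k → Vec n × ℚ) λ L →
    (∀ j → IsFacetIneq V (Data.Product.proj₁ (L j)) (Data.Product.proj₂ (L j))) ×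
    (∀ i j → i ≢ j → ¬ SameIneq (L i) (L j)) ×
    (∀ a b → IsFacetIneq V a b → ∃ λ j → SameIneq (a , b) (L j))

-- Ordinal sum P ⊕ Q on Fin (s + t): first s indices carry P, last t carry Q.
ordSum⊎ : {s t : ℕ} → Rel s → Rel t → (Fin s ⊎ Fin t) → (Fin s ⊎ Fin t) → Set
ordSum⊎ P Q (inj₁ i) (inj₁ j) = P i j
ordSum⊎ P Q (inj₂ i) (inj₂ j) = Q i j
ordSum⊎ P Q (inj₁ i) (inj₂ j) = ⊤
ordSum⊎ P Q (inj₂ i) (inj₁ j) = ⊥

_⊕_ : {s t : ℕ} → Rel s → Rel t → Rel (s ℕ.+ t)
_⊕_ {s} P Q i j = ordSum⊎ P Q (splitAt s i) (splitAt s j)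

-- Every element of P₁ lies below every element of P₂ in P₁ ⊕ P₂, so an antichain of
-- the ordinal sum lies entirely in one summand.  Hence the points generating
-- Γ(P₁ ⊕ P₂, Q₁ ⊕ Q₂) are V₁ × {0} ∪ {0} × V₂, where Vᵢ generates Γ(Pᵢ, Qᵢ):
-- the polytope is the free sum of Γ(P₁, Q₁) and Γ(P₂, Q₂).  Each Vᵢ contains ±eⱼ
-- for all j (singleton antichains), so every facet inequality a · x ≤ b has b > 0.
-- Normalised to b = 1, the facets of the free sum are exactly the (a₁ , a₂) with aᵢ
-- a facet of the i-th summand: the tight points of a facet of the sum split into
-- points of V₁ × {0} and of {0} × V₂, independent in each block, and a rank count
-- forces exactly s and t of them; conversely the tight points of a₁ and a₂ together
-- form a block-diagonal, hence independent, family.  The bound follows from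
-- (n₁ n₂)² = n₁² n₂² ≤ 6ˢ 6ᵗ.

module Submission where

open import Defs
open import Data.Nat as ℕ using (ℕ; zero; suc; NonZero; z≤n; s≤s; _^_)
import Data.Nat.Properties as ℕₚ
open import Data.Fin as Fin using (Fin; zero; suc; punchIn; _↑ˡ_; _↑ʳ_; splitAt)
import Data.Fin.Properties as Finₚ
open import Data.Vec.Functional using (_++_; take; drop; tail; insertAt)
open import Data.Vec.Functional.Properties using (lookup-++ˡ; lookup-++ʳ; insertAt-lookup; insertAt-punchIn)
open import Data.Rational using (ℚ; 0ℚ; 1ℚ; _+_; _*_; -_; _≤_; _<_; 1/_; ≢-nonZero)
import Data.Rational.Properties as ℚₚ
open import Data.Rational.Solver using (module +-*-Solver)
open import Algebra.Properties.CommutativeSemigroup ℕₚ.*-commutativeSemigroup using (interchange)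
open import Data.Product using (∃; _×_; _,_; proj₁; proj₂; uncurry; map₁)
open import Data.Sum using (_⊎_; inj₁; inj₂)
import Data.Sum as Sum
open import Data.Empty using (⊥-elim)
open import Data.Bool using (Bool; true; false; not; if_then_else_)
import Data.Bool.Properties as Boolₚ
open import Function using (_∘_)
open import Relation.Nullary using (¬_; yes; no; does)
open import Relation.Nullary.Decidable using (dec-true; dec-false)
open import Relation.Binary.Definitions using (tri<; tri≈; tri>)
open import Relation.Binary.PropositionalEquality
open import Relation.Binary.Structures using (IsPartialOrder)

open +-*-Solver

>0⇒≢0 : ∀ {p} → 0ℚ < p → p ≢ 0ℚ
>0⇒≢0 p>0 p≡0 = ℚₚ.<⇒≢ p>0 (sym p≡0)

*-pos : ∀ {p q} → 0ℚ < p → 0ℚ < q → 0ℚ < p * q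
*-pos {p} {q} p>0 q>0 = ℚₚ.positive⁻¹ (p * q)
  {{ℚₚ.pos*pos⇒pos p {{Data.Rational.positive p>0}} q {{Data.Rational.positive q>0}}}}

*-cancelˡ-≢0 : ∀ {p x y} → p ≢ 0ℚ → p * x ≡ p * y → x ≡ y
*-cancelˡ-≢0 {p} {x} {y} p≢0 px≡py = begin
  x                ≡⟨ inverse-cancels x ⟩
  1/ p * (p * x)   ≡⟨ cong (1/ p *_) px≡py ⟩
  1/ p * (p * y)   ≡⟨ inverse-cancels y ⟨
  y                ∎
  where
  open ≡-Reasoning
  instance
    p-nonZero : Data.Rational.NonZero p
    p-nonZero = ≢-nonZero p≢0
  inverse-cancels : ∀ z → z ≡ 1/ p * (p * z)
  inverse-cancels z = trans (sym (ℚₚ.*-identityˡ z))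
    (trans (cong (_* z) (sym (ℚₚ.*-inverseˡ p))) (ℚₚ.*-assoc (1/ p) p z))

*-≢0 : ∀ {p q} → p ≢ 0ℚ → q ≢ 0ℚ → p * q ≢ 0ℚ
*-≢0 {p} {q} p≢0 q≢0 pq≡0 = q≢0 (*-cancelˡ-≢0 p≢0 (trans pq≡0 (sym (ℚₚ.*-zeroʳ p))))

*-monoˡ-≤-pos : ∀ {c u v} → 0ℚ < c → u ≤ v → c * u ≤ c * v
*-monoˡ-≤-pos {c} c>0 = ℚₚ.*-monoˡ-≤-nonNeg c {{ℚₚ.pos⇒nonNeg c {{Data.Rational.positive c>0}}}}

sumFin-cong : ∀ n {f g : Fin n → ℚ} → (∀ i → f i ≡ g i) → sumFin n f ≡ sumFin n g
sumFin-cong zero    f≗g = refl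
sumFin-cong (suc n) f≗g = cong₂ _+_ (f≗g zero) (sumFin-cong n (λ i → f≗g (suc i)))

sumFin-zero : ∀ n {f : Fin n → ℚ} → (∀ i → f i ≡ 0ℚ) → sumFin n f ≡ 0ℚ
sumFin-zero zero    f≡0 = refl
sumFin-zero (suc n) f≡0 = trans (cong₂ _+_ (f≡0 zero) (sumFin-zero n (λ i → f≡0 (suc i)))) (ℚₚ.+-identityˡ 0ℚ)

sumFin-+ : ∀ n (f g : Fin n → ℚ) → sumFin n (λ i → f i + g i) ≡ sumFin n f + sumFin n g
sumFin-+ zero    f g = refl
sumFin-+ (suc n) f g = trans (cong (f zero + g zero +_) (sumFin-+ n (f ∘ suc) (g ∘ suc)))
  (solve 4 (λ a b c d → (a :+ b) :+ (c :+ d) := (a :+ c) :+ (b :+ d)) refl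
    (f zero) (g zero) (sumFin n (f ∘ suc)) (sumFin n (g ∘ suc)))

sumFin-*ˡ : ∀ n c (f : Fin n → ℚ) → sumFin n (λ i → c * f i) ≡ c * sumFin n f
sumFin-*ˡ zero    c f = sym (ℚₚ.*-zeroʳ c)
sumFin-*ˡ (suc n) c f =
  trans (cong (c * f zero +_) (sumFin-*ˡ n c (f ∘ suc))) (sym (ℚₚ.*-distribˡ-+ c _ _))

sumFin-*ʳ : ∀ n c (f : Fin n → ℚ) → sumFin n (λ i → f i * c) ≡ sumFin n f * c
sumFin-*ʳ n c f = trans (sumFin-cong n (λ i → ℚₚ.*-comm (f i) c)) (trans (sumFin-*ˡ n c f) (ℚₚ.*-comm c _))

sumFin-neg : ∀ n (f : Fin n → ℚ) → sumFin n (λ i → - f i) ≡ - sumFin n f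
sumFin-neg zero    f = refl
sumFin-neg (suc n) f =
  trans (cong (- f zero +_) (sumFin-neg n (f ∘ suc))) (sym (ℚₚ.neg-distrib-+ (f zero) _))

sumFin-swap : ∀ m n (f : Fin m → Fin n → ℚ) →
  sumFin m (λ j → sumFin n (f j)) ≡ sumFin n (λ i → sumFin m (λ j → f j i))
sumFin-swap zero    n f = sym (sumFin-zero n (λ _ → refl))
sumFin-swap (suc m) n f =
  trans (cong (sumFin n (f zero) +_) (sumFin-swap m n (f ∘ suc)))
        (sym (sumFin-+ n (f zero) (λ i → sumFin m (λ j → f (suc j) i))))

sumFin-++ : ∀ s {t} (f : Fin (s ℕ.+ t) → ℚ) → sumFin (s ℕ.+ t) f ≡ sumFin s (take s f) + sumFin t (drop s f)
sumFin-++ zero    f = sym (ℚₚ.+-identityˡ _)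
sumFin-++ (suc s) f = trans (cong (f zero +_) (sumFin-++ s (f ∘ suc))) (sym (ℚₚ.+-assoc (f zero) _ _))

sumFin-punchIn : ∀ n (j : Fin (suc n)) (f : Fin (suc n) → ℚ) →
  sumFin (suc n) f ≡ f j + sumFin n (f ∘ punchIn j)
sumFin-punchIn n       zero    f = refl
sumFin-punchIn (suc n) (suc j) f =
  trans (cong (f zero +_) (sumFin-punchIn n j (f ∘ suc)))
        (solve 3 (λ a b c → a :+ (b :+ c) := b :+ (a :+ c)) refl (f zero) (f (suc j)) _)

0ᵛ : ∀ {n} → Vec n
0ᵛ _ = 0ℚ

·-congˡ : ∀ {n} {a a' : Vec n} (x : Vec n) → a ≗v a' → a · x ≡ a' · x
·-congˡ {n} x a≗a' = sumFin-cong n (λ i → cong (_* x i) (a≗a' i))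

·-congʳ : ∀ {n} (a : Vec n) {x x' : Vec n} → x ≗v x' → a · x ≡ a · x'
·-congʳ {n} a x≗x' = sumFin-cong n (λ i → cong (a i *_) (x≗x' i))

·-zeroʳ : ∀ {n} (a : Vec n) {x : Vec n} → x ≗v 0ᵛ → a · x ≡ 0ℚ
·-zeroʳ {n} a x≗0 = sumFin-zero n (λ i → trans (cong (a i *_) (x≗0 i)) (ℚₚ.*-zeroʳ (a i)))

·-zeroˡ : ∀ {n} (a x : Vec n) → a ≗v 0ᵛ → a · x ≡ 0ℚ
·-zeroˡ {n} a x a≗0 = sumFin-zero n (λ i → trans (cong (_* x i) (a≗0 i)) (ℚₚ.*-zeroˡ (x i)))

·-neg : ∀ {n} (a x : Vec n) → a · (λ i → - x i) ≡ - (a · x)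
·-neg {n} a x = trans (sumFin-cong n (λ i → sym (ℚₚ.neg-distribʳ-* (a i) (x i)))) (sumFin-neg n _)

·-*ˡ : ∀ {n} c (a x : Vec n) → (λ i → c * a i) · x ≡ c * (a · x)
·-*ˡ {n} c a x = trans (sumFin-cong n (λ i → ℚₚ.*-assoc c (a i) (x i))) (sumFin-*ˡ n c _)

·-split : ∀ s {t} (a x : Vec (s ℕ.+ t)) → a · x ≡ take s a · take s x + drop s a · drop s x
·-split s a x = sumFin-++ s (λ i → a i * x i)

·-++ : ∀ {s t} (a : Vec (s ℕ.+ t)) (x : Vec s) (y : Vec t) → a · (x ++ y) ≡ take s a · x + drop s a · y
·-++ {s} a x y = trans (·-split s a (x ++ y))
  (cong₂ _+_ (·-congʳ (take s a) (lookup-++ˡ x y)) (·-congʳ (drop s a) (lookup-++ʳ x y)))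

++-· : ∀ {s t} (a : Vec s) (a' : Vec t) (x : Vec (s ℕ.+ t)) → (a ++ a') · x ≡ a · take s x + a' · drop s x
++-· {s} a a' x = trans (·-split s (a ++ a') x)
  (cong₂ _+_ (·-congˡ (take s x) (lookup-++ˡ a a')) (·-congˡ (drop s x) (lookup-++ʳ a a')))

splitAt-elim : ∀ {s t} {P : Fin (s ℕ.+ t) → Set} →
  (∀ k → P (k ↑ˡ t)) → (∀ k → P (s ↑ʳ k)) → ∀ i → P i
splitAt-elim {s} {P = P} left right i with splitAt s i in eq
... | inj₁ k = subst P (Finₚ.splitAt⁻¹-↑ˡ eq) (left k)
... | inj₂ k = subst P (Finₚ.splitAt⁻¹-↑ʳ eq) (right k)

-- Linear independence and rank

linComb : ∀ {m n} → (Fin m → ℚ) → (Fin m → Vec n) → Vec n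
linComb {m} c w i = sumFin m (λ j → c j * w j i)

LinearlyIndependent : ∀ {m n} → (Fin m → Vec n) → Set
LinearlyIndependent {m} w = (c : Fin m → ℚ) → linComb c w ≗v 0ᵛ → ∀ j → c j ≡ 0ℚ

linComb-zero : ∀ {ℓ n} (c : Fin ℓ → ℚ) (u : Fin ℓ → Vec n) i → (∀ k → u k i ≡ 0ℚ) → linComb c u i ≡ 0ℚ
linComb-zero {ℓ} c u i u≡0 = sumFin-zero ℓ (λ k → trans (cong (c k *_) (u≡0 k)) (ℚₚ.*-zeroʳ (c k)))

·-linComb : ∀ {m n} (a : Vec n) (c : Fin m → ℚ) (w : Fin m → Vec n) →
  a · linComb c w ≡ sumFin m (λ j → c j * (a · w j))
·-linComb {m} {n} a c w = begin
  sumFin n (λ i → a i * sumFin m (λ j → c j * w j i))   ≡⟨ sumFin-cong n (λ i → sym (sumFin-*ˡ m (a i) _)) ⟩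
  sumFin n (λ i → sumFin m (λ j → a i * (c j * w j i))) ≡⟨ sumFin-swap n m _ ⟩
  sumFin m (λ j → sumFin n (λ i → a i * (c j * w j i))) ≡⟨ sumFin-cong m (λ j → trans (sumFin-cong n (λ i → reorder (a i) (c j) (w j i))) (sumFin-*ˡ n (c j) _)) ⟩
  sumFin m (λ j → c j * (a · w j))                      ∎
  where
  open ≡-Reasoning
  reorder : ∀ x y z → x * (y * z) ≡ y * (x * z)
  reorder = solve 3 (λ x y z → x :* (y :* z) := y :* (x :* z)) refl

linComb-insertAt : ∀ {m n} (c : Fin m → ℚ) (j : Fin (suc m)) x (w : Fin (suc m) → Vec n) i →
  linComb (insertAt c j x) w i ≡ x * w j i + linComb c (w ∘ punchIn j) i
linComb-insertAt {m} c j x w i =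
  trans (sumFin-punchIn m j (λ k → insertAt c j x k * w k i))
        (cong₂ _+_ (cong (_* w j i) (insertAt-lookup c j x))
                   (sumFin-cong m (λ k → cong (_* w (punchIn j k) i) (insertAt-punchIn c j x k))))

independent-tail : ∀ {m n} (w : Fin m → Vec (suc n)) → (∀ j → w j zero ≡ 0ℚ) →
  LinearlyIndependent w → LinearlyIndependent (tail ∘ w)
independent-tail w column≡0 ind c comb≡0 = ind c λ where
  zero    → linComb-zero c w zero column≡0
  (suc i) → comb≡0 i

module PivotElimination {m n} (w : Fin (suc m) → Vec (suc n)) (j : Fin (suc m)) (pivot≢0 : w j zero ≢ 0ℚ) where

  private
    pivot : ℚ
    pivot = w j zero
    instance
      pivot-nonZero : Data.Rational.NonZero pivot
      pivot-nonZero = ≢-nonZero pivot≢0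

  multiplier : Fin m → ℚ
  multiplier k = w (punchIn j k) zero * 1/ pivot

  eliminated : Fin m → Vec n
  eliminated k i = w (punchIn j k) (suc i) + - (multiplier k * w j (suc i))

  multiplier-pivot : ∀ k → multiplier k * pivot ≡ w (punchIn j k) zero
  multiplier-pivot k = trans (ℚₚ.*-assoc (w (punchIn j k) zero) (1/ pivot) pivot)
    (trans (cong (w (punchIn j k) zero *_) (ℚₚ.*-inverseˡ pivot)) (ℚₚ.*-identityʳ _))

  linComb-eliminated : ∀ c i → linComb c eliminated i ≡
    linComb c (w ∘ punchIn j) (suc i) + - (sumFin m (λ k → c k * multiplier k) * w j (suc i))
  linComb-eliminated c i = begin
    sumFin m (λ k → c k * eliminated k i)
      ≡⟨ sumFin-cong m (λ k → distribute (c k) (w (punchIn j k) (suc i)) (multiplier k) (w j (suc i))) ⟩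
    sumFin m (λ k → c k * w (punchIn j k) (suc i) + - (c k * multiplier k * w j (suc i)))
      ≡⟨ trans (sumFin-+ m _ _) (cong (linComb c (w ∘ punchIn j) (suc i) +_) (sumFin-neg m _)) ⟩
    linComb c (w ∘ punchIn j) (suc i) + - sumFin m (λ k → c k * multiplier k * w j (suc i))
      ≡⟨ cong (λ z → linComb c (w ∘ punchIn j) (suc i) + - z) (sumFin-*ʳ m (w j (suc i)) _) ⟩
    linComb c (w ∘ punchIn j) (suc i) + - (sumFin m (λ k → c k * multiplier k) * w j (suc i)) ∎
    where
    open ≡-Reasoning
    distribute : ∀ c u r v → c * (u + - (r * v)) ≡ c * u + - (c * r * v)
    distribute = solve 4 (λ c u r v → c :* (u :+ :- (r :* v)) := c :* u :+ :- (c :* r :* v)) refl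

  -- A relation among the eliminated rows lifts to one among the rows of w, with
  -- coefficient x at the pivot row chosen to cancel the first column.
  eliminated-independent : LinearlyIndependent w → LinearlyIndependent eliminated
  eliminated-independent ind c comb≡0 k =
    trans (sym (insertAt-punchIn c j x k)) (ind (insertAt c j x) extended≡0 (punchIn j k))
    where
    S : ℚ
    S = sumFin m (λ k → c k * multiplier k)
    x : ℚ
    x = - S
    extended≡0 : linComb (insertAt c j x) w ≗v 0ᵛ
    extended≡0 zero = begin
      linComb (insertAt c j x) w zero   ≡⟨ linComb-insertAt c j x w zero ⟩
      x * pivot + linComb c (w ∘ punchIn j) zero
        ≡⟨ cong (x * pivot +_) (sumFin-cong m (λ k → trans (cong (c k *_) (sym (multiplier-pivot k))) (sym (ℚₚ.*-assoc (c k) _ pivot)))) ⟩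
      x * pivot + sumFin m (λ k → c k * multiplier k * pivot)
        ≡⟨ cong (x * pivot +_) (sumFin-*ʳ m pivot _) ⟩
      - S * pivot + S * pivot           ≡⟨ solve 2 (λ S p → :- S :* p :+ S :* p := con 0ℚ) refl S pivot ⟩
      0ℚ                                ∎
      where open ≡-Reasoning
    extended≡0 (suc i) = begin
      linComb (insertAt c j x) w (suc i)   ≡⟨ linComb-insertAt c j x w (suc i) ⟩
      - S * w j (suc i) + linComb c (w ∘ punchIn j) (suc i)
        ≡⟨ solve 3 (λ S v A → :- S :* v :+ A := A :+ :- (S :* v)) refl S (w j (suc i)) _ ⟩
      linComb c (w ∘ punchIn j) (suc i) + - (S * w j (suc i)) ≡⟨ linComb-eliminated c i ⟨
      linComb c eliminated i               ≡⟨ comb≡0 i ⟩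
      0ℚ                                   ∎
      where open ≡-Reasoning

independent⇒≤ : ∀ {m n} (w : Fin m → Vec n) → LinearlyIndependent w → m ℕ.≤ n
independent⇒≤ {zero}          w ind = z≤n
independent⇒≤ {suc m} {zero}  w ind = ⊥-elim (ℚₚ.1≢0 (ind (λ _ → 1ℚ) (λ ()) zero))
independent⇒≤ {suc m} {suc n} w ind with Finₚ.all? (λ j → w j zero ℚₚ.≟ 0ℚ)
... | yes column≡0 = ℕₚ.m≤n⇒m≤1+n (independent⇒≤ (tail ∘ w) (independent-tail w column≡0 ind))
... | no column≢0 with Finₚ.¬∀⟶∃¬ _ _ (λ j → w j zero ℚₚ.≟ 0ℚ) column≢0
...   | j , pivot≢0 = s≤s (independent⇒≤ eliminated (eliminated-independent ind))
  where open PivotElimination w j pivot≢0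

count : ∀ {m} → (Fin m → Bool) → ℕ
count {zero}  p = 0
count {suc m} p = if p zero then suc (count (tail p)) else count (tail p)

select : ∀ {m} (p : Fin m → Bool) → Fin (count p) → Fin m
select {suc m} p k with p zero
select {suc m} p zero    | true  = zero
select {suc m} p (suc k) | true  = suc (select (tail p) k)
select {suc m} p k       | false = suc (select (tail p) k)

spread : ∀ {m} (p : Fin m → Bool) → (Fin (count p) → ℚ) → Fin m → ℚ
spread {suc m} p c i with p zero
spread {suc m} p c zero    | true  = c zero
spread {suc m} p c (suc i) | true  = spread (tail p) (c ∘ suc) i
spread {suc m} p c zero    | false = 0ℚ
spread {suc m} p c (suc i) | false = spread (tail p) c i

select-true : ∀ {m} (p : Fin m → Bool) k → p (select p k) ≡ true
select-true {suc m} p k with p zero in eq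
select-true {suc m} p zero    | true  = eq
select-true {suc m} p (suc k) | true  = select-true (tail p) k
select-true {suc m} p k       | false = select-true (tail p) k

spread-select : ∀ {m} (p : Fin m → Bool) c k → spread p c (select p k) ≡ c k
spread-select {suc m} p c k with p zero
spread-select {suc m} p c zero    | true  = refl
spread-select {suc m} p c (suc k) | true  = spread-select (tail p) (c ∘ suc) k
spread-select {suc m} p c k       | false = spread-select (tail p) c k

sumFin-spread : ∀ {m} (p : Fin m → Bool) c (f : Fin m → ℚ) →
  sumFin m (λ i → spread p c i * f i) ≡ sumFin (count p) (λ k → c k * f (select p k))
sumFin-spread {zero}  p c f = refl
sumFin-spread {suc m} p c f with p zero
... | true  = cong (c zero * f zero +_) (sumFin-spread (tail p) (c ∘ suc) (tail f))
... | false = trans (cong₂ _+_ (ℚₚ.*-zeroˡ (f zero)) (sumFin-spread (tail p) c (tail f))) (ℚₚ.+-identityˡ _)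

count+count-not : ∀ {m} (p : Fin m → Bool) → count p ℕ.+ count (not ∘ p) ≡ m
count+count-not {zero}  p = refl
count+count-not {suc m} p with p zero
... | true  = cong suc (count+count-not (tail p))
... | false = trans (ℕₚ.+-suc _ _) (cong suc (count+count-not (tail p)))

independent-select : ∀ {m n} {w : Fin m → Vec n} (p : Fin m → Bool) →
  LinearlyIndependent w → LinearlyIndependent (w ∘ select p)
independent-select {w = w} p ind c comb≡0 k = trans (sym (spread-select p c k))
  (ind (spread p c) (λ i → trans (sumFin-spread p c (λ j → w j i)) (comb≡0 i)) (select p k))

independent-take : ∀ {ℓ s t} (u : Fin ℓ → Vec (s ℕ.+ t)) → (∀ k → drop s (u k) ≗v 0ᵛ) →
  LinearlyIndependent u → LinearlyIndependent (take s ∘ u)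
independent-take {s = s} u right≡0 ind c comb≡0 =
  ind c (splitAt-elim comb≡0 (λ i → linComb-zero c u (s ↑ʳ i) (λ k → right≡0 k i)))

independent-drop : ∀ {ℓ s t} (u : Fin ℓ → Vec (s ℕ.+ t)) → (∀ k → take s (u k) ≗v 0ᵛ) →
  LinearlyIndependent u → LinearlyIndependent (drop s ∘ u)
independent-drop {t = t} u left≡0 ind c comb≡0 =
  ind c (splitAt-elim (λ i → linComb-zero c u (i ↑ˡ t) (λ k → left≡0 k i)) comb≡0)

linComb-++ : ∀ {ℓ₁ ℓ₂ n} (c : Fin (ℓ₁ ℕ.+ ℓ₂) → ℚ) (u : Fin ℓ₁ → Vec n) (v : Fin ℓ₂ → Vec n) i →
  linComb c (u ++ v) i ≡ linComb (take ℓ₁ c) u i + linComb (drop ℓ₁ c) v i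
linComb-++ {ℓ₁} {ℓ₂} c u v i = trans (sumFin-++ ℓ₁ (λ k → c k * (u ++ v) k i))
  (cong₂ _+_ (sumFin-cong ℓ₁ (λ k → cong (λ x → c (k ↑ˡ ℓ₂) * x i) (lookup-++ˡ u v k)))
             (sumFin-cong ℓ₂ (λ k → cong (λ x → c (ℓ₁ ↑ʳ k) * x i) (lookup-++ʳ u v k))))

blockDiagonal : ∀ {ℓ₁ ℓ₂ s t} → (Fin ℓ₁ → Vec s) → (Fin ℓ₂ → Vec t) → Fin (ℓ₁ ℕ.+ ℓ₂) → Vec (s ℕ.+ t)
blockDiagonal u v = (λ k → u k ++ 0ᵛ) ++ (λ k → 0ᵛ ++ v k)

linComb-blockDiagonal-↑ˡ : ∀ {ℓ₁ ℓ₂ s t} (c : Fin (ℓ₁ ℕ.+ ℓ₂) → ℚ) (u : Fin ℓ₁ → Vec s) (v : Fin ℓ₂ → Vec t) i →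
  linComb c (blockDiagonal u v) (i ↑ˡ t) ≡ linComb (take ℓ₁ c) u i
linComb-blockDiagonal-↑ˡ {ℓ₁} {ℓ₂} {t = t} c u v i = trans (linComb-++ c (λ k → u k ++ 0ᵛ) (λ k → 0ᵛ ++ v k) (i ↑ˡ t))
  (trans (cong₂ _+_ (sumFin-cong ℓ₁ (λ k → cong (take ℓ₁ c k *_) (lookup-++ˡ (u k) 0ᵛ i)))
                    (linComb-zero (drop ℓ₁ c) (λ k → 0ᵛ ++ v k) (i ↑ˡ t) (λ k → lookup-++ˡ 0ᵛ (v k) i)))
         (ℚₚ.+-identityʳ _))

linComb-blockDiagonal-↑ʳ : ∀ {ℓ₁ ℓ₂ s t} (c : Fin (ℓ₁ ℕ.+ ℓ₂) → ℚ) (u : Fin ℓ₁ → Vec s) (v : Fin ℓ₂ → Vec t) i →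
  linComb c (blockDiagonal u v) (s ↑ʳ i) ≡ linComb (drop ℓ₁ c) v i
linComb-blockDiagonal-↑ʳ {ℓ₁} {ℓ₂} {s} c u v i = trans (linComb-++ c (λ k → u k ++ 0ᵛ) (λ k → 0ᵛ ++ v k) (s ↑ʳ i))
  (trans (cong₂ _+_ (linComb-zero (take ℓ₁ c) (λ k → u k ++ 0ᵛ) (s ↑ʳ i) (λ k → lookup-++ʳ (u k) 0ᵛ i))
                    (sumFin-cong ℓ₂ (λ k → cong (drop ℓ₁ c k *_) (lookup-++ʳ (0ᵛ {s}) (v k) i))))
         (ℚₚ.+-identityˡ _))

independent-blockDiagonal : ∀ {ℓ₁ ℓ₂ s t} {u : Fin ℓ₁ → Vec s} {v : Fin ℓ₂ → Vec t} →
  LinearlyIndependent u → LinearlyIndependent v → LinearlyIndependent (blockDiagonal u v)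
independent-blockDiagonal {ℓ₁} {u = u} {v} ind-u ind-v c comb≡0 = splitAt-elim
  (ind-u (take ℓ₁ c) (λ i → trans (sym (linComb-blockDiagonal-↑ˡ c u v i)) (comb≡0 _)))
  (ind-v (drop ℓ₁ c) (λ i → trans (sym (linComb-blockDiagonal-↑ʳ c u v i)) (comb≡0 _)))

isLeft : ∀ {A B : Set} → A ⊎ B → Bool
isLeft (inj₁ _) = true
isLeft (inj₂ _) = false

fromLeft : ∀ {A B : Set} (d : A ⊎ B) → isLeft d ≡ true → A
fromLeft (inj₁ x) _ = x

fromRight : ∀ {A B : Set} (d : A ⊎ B) → not (isLeft d) ≡ true → B
fromRight (inj₂ y) _ = y

≤-+-tightˡ : ∀ {a b m n} → a ℕ.≤ m → b ℕ.≤ n → a ℕ.+ b ≡ m ℕ.+ n → a ≡ m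
≤-+-tightˡ {a} {b} {m} {n} a≤m b≤n a+b≡m+n = ℕₚ.≤-antisym a≤m
  (ℕₚ.+-cancelʳ-≤ n m a (ℕₚ.≤-trans (ℕₚ.≤-reflexive (sym a+b≡m+n)) (ℕₚ.+-monoʳ-≤ a b≤n)))

module BlockDecomposition {s t} {A B : Fin (s ℕ.+ t) → Set}
  (w : Fin (s ℕ.+ t) → Vec (s ℕ.+ t)) (ind : LinearlyIndependent w) (d : ∀ j → A j ⊎ B j)
  (A⇒upper : ∀ {j} → A j → drop s (w j) ≗v 0ᵛ) (B⇒lower : ∀ {j} → B j → take s (w j) ≗v 0ᵛ) where

  private
    p : Fin (s ℕ.+ t) → Bool
    p = isLeft ∘ d

  upperIndex : Fin (count p) → Fin (s ℕ.+ t)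
  upperIndex = select p

  lowerIndex : Fin (count (not ∘ p)) → Fin (s ℕ.+ t)
  lowerIndex = select (not ∘ p)

  upperIndex-A : ∀ k → A (upperIndex k)
  upperIndex-A k = fromLeft (d (upperIndex k)) (select-true p k)

  lowerIndex-B : ∀ k → B (lowerIndex k)
  lowerIndex-B k = fromRight (d (lowerIndex k)) (select-true (not ∘ p) k)

  upper-independent : LinearlyIndependent (take s ∘ w ∘ upperIndex)
  upper-independent = independent-take (w ∘ upperIndex) (A⇒upper ∘ upperIndex-A) (independent-select p ind)

  lower-independent : LinearlyIndependent (drop s ∘ w ∘ lowerIndex)
  lower-independent = independent-drop (w ∘ lowerIndex) (B⇒lower ∘ lowerIndex-B) (independent-select (not ∘ p) ind)

  private
    upper≤ : count p ℕ.≤ s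
    upper≤ = independent⇒≤ _ upper-independent
    lower≤ : count (not ∘ p) ℕ.≤ t
    lower≤ = independent⇒≤ _ lower-independent

  -- Each block has at most as many members as its dimension, and s + t in total.
  count-upper : count p ≡ s
  count-upper = ≤-+-tightˡ upper≤ lower≤ (count+count-not p)

  count-lower : count (not ∘ p) ≡ t
  count-lower = ≤-+-tightˡ lower≤ upper≤ (trans (ℕₚ.+-comm _ (count p)) (trans (count+count-not p) (ℕₚ.+-comm s t)))

-- Facets

-- For b ≢ 0 this is IsFacetIneq: on a hyperplane missing the origin, affine and
-- linear independence agree (hyperplane-coefficients).
record IsLinearFacet {n} (V : Vec n → Set) (a : Vec n) (b : ℚ) : Set where
  field
    valid       : ∀ x → V x → a · x ≤ b
    vertex      : Fin n → Vec n
    vertex∈V    : ∀ j → V (vertex j)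
    tight       : ∀ j → a · vertex j ≡ b
    independent : LinearlyIndependent vertex

linearFacet : ∀ {ℓ n} {V : Vec n → Set} {a b} → ℓ ≡ n → (w : Fin ℓ → Vec n) →
  (∀ x → V x → a · x ≤ b) → (∀ j → V (w j)) → (∀ j → a · w j ≡ b) → LinearlyIndependent w →
  IsLinearFacet V a b
linearFacet refl w valid w∈V tight ind = record
  { valid = valid ; vertex = w ; vertex∈V = w∈V ; tight = tight ; independent = ind }

hyperplane-coefficients : ∀ {m n} (a : Vec n) {b} {w : Fin m → Vec n} → b ≢ 0ℚ → (∀ j → a · w j ≡ b) →
  ∀ c → linComb c w ≗v 0ᵛ → sumFin m c ≡ 0ℚ
hyperplane-coefficients {m} a {b} {w} b≢0 tight c comb≡0 = *-cancelˡ-≢0 b≢0 (begin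
  b * sumFin m c                     ≡⟨ trans (sumFin-*ʳ m b c) (ℚₚ.*-comm (sumFin m c) b) ⟨
  sumFin m (λ j → c j * b)           ≡⟨ sumFin-cong m (λ j → cong (c j *_) (tight j)) ⟨
  sumFin m (λ j → c j * (a · w j))   ≡⟨ ·-linComb a c w ⟨
  a · linComb c w                    ≡⟨ ·-zeroʳ a comb≡0 ⟩
  0ℚ                                 ≡⟨ ℚₚ.*-zeroʳ b ⟨
  b * 0ℚ                             ∎)
  where open ≡-Reasoning

facet⇒linearFacet : ∀ {n} {V : Vec n → Set} {a b} → b ≢ 0ℚ → IsFacetIneq V a b → IsLinearFacet V a b
facet⇒linearFacet {a = a} b≢0 (_ , valid , w , w∈V , tight , affine) = record
  { valid = valid ; vertex = w ; vertex∈V = w∈V ; tight = tight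
  ; independent = λ c comb≡0 → affine c (hyperplane-coefficients a b≢0 tight c comb≡0) comb≡0 }

·≢0⇒nonzero-coordinate : ∀ {n} (a x : Vec n) → a · x ≢ 0ℚ → ∃ λ i → a i ≢ 0ℚ
·≢0⇒nonzero-coordinate a x a·x≢0 with Finₚ.all? (λ i → a i ℚₚ.≟ 0ℚ)
... | yes a≡0 = ⊥-elim (a·x≢0 (·-zeroˡ a x a≡0))
... | no  a≢0 = Finₚ.¬∀⟶∃¬ _ _ (λ i → a i ℚₚ.≟ 0ℚ) a≢0

linearFacet⇒facet : ∀ {n} .{{_ : NonZero n}} {V : Vec n → Set} {a b} → b ≢ 0ℚ →
  IsLinearFacet V a b → IsFacetIneq V a b
linearFacet⇒facet {suc n} {a = a} b≢0 F =
  ·≢0⇒nonzero-coordinate a (vertex zero) (b≢0 ∘ trans (sym (tight zero))) ,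
  valid , vertex , vertex∈V , tight , λ c _ → independent c
  where open IsLinearFacet F

singleton : ∀ {n} → Fin n → Fin n → Bool
singleton i j = does (i Fin.≟ j)

basis : ∀ {n} → Fin n → Vec n
basis i = ρ (singleton i)

ContainsCrossPolytope : ∀ {n} → (Vec n → Set) → Set
ContainsCrossPolytope V = ∀ i → V (basis i) × V (λ j → - basis i j)

·-basis : ∀ {n} (a : Vec n) i → a · basis i ≡ a i
·-basis {suc n} a i = begin
  a · basis i
    ≡⟨ sumFin-punchIn n i (λ j → a j * basis i j) ⟩
  a i * basis i i + sumFin n (λ k → a (punchIn i k) * basis i (punchIn i k))
    ≡⟨ cong₂ _+_ (cong (a i *_) here) (sumFin-zero n (λ k → trans (cong (a (punchIn i k) *_) (there k)) (ℚₚ.*-zeroʳ (a (punchIn i k))))) ⟩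
  a i * 1ℚ + 0ℚ
    ≡⟨ trans (ℚₚ.+-identityʳ _) (ℚₚ.*-identityʳ (a i)) ⟩
  a i ∎
  where
  open ≡-Reasoning
  here : basis i i ≡ 1ℚ
  here = cong (if_then 1ℚ else 0ℚ) (dec-true (i Fin.≟ i) refl)
  there : ∀ k → basis i (punchIn i k) ≡ 0ℚ
  there k = cong (if_then 1ℚ else 0ℚ) (dec-false (i Fin.≟ punchIn i k) (Finₚ.punchInᵢ≢i i k ∘ sym))

valid⇒rhs>0 : ∀ {n} {V : Vec n → Set} {a b} → ContainsCrossPolytope V →
  (∀ x → V x → a · x ≤ b) → ∀ i → a i ≢ 0ℚ → 0ℚ < b
valid⇒rhs>0 {a = a} {b} cross valid i aᵢ≢0 with ℚₚ.<-cmp (a i) 0ℚ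
... | tri< aᵢ<0 _ _ = ℚₚ.<-≤-trans (ℚₚ.neg-antimono-< aᵢ<0)
  (subst (_≤ b) (trans (·-neg a (basis i)) (cong -_ (·-basis a i))) (valid _ (proj₂ (cross i))))
... | tri≈ _ aᵢ≡0 _ = ⊥-elim (aᵢ≢0 aᵢ≡0)
... | tri> _ _ aᵢ>0 = ℚₚ.<-≤-trans aᵢ>0 (subst (_≤ b) (·-basis a i) (valid _ (proj₁ (cross i))))

crossPolytope-facet-rhs>0 : ∀ {n} {V : Vec n → Set} {a b} → ContainsCrossPolytope V → IsFacetIneq V a b → 0ℚ < b
crossPolytope-facet-rhs>0 {a = a} cross ((i , aᵢ≢0) , valid , _) = valid⇒rhs>0 {a = a} cross valid i aᵢ≢0

-- Free sums

-- Proportionality by cross-multiplication; for positive right-hand sides it is SameIneq.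
_∝_ : ∀ {n} → Vec n × ℚ → Vec n × ℚ → Set
(a , b) ∝ (a' , b') = ∀ i → b' * a i ≡ b * a' i

sameIneq⇒∝ : ∀ {n} (p q : Vec n × ℚ) → SameIneq p q → p ∝ q
sameIneq⇒∝ (a , b) (a' , b') (μ , _ , a'≡μa , b'≡μb) i = begin
  b' * a i         ≡⟨ cong (_* a i) b'≡μb ⟩
  μ * b * a i      ≡⟨ solve 3 (λ μ b x → μ :* b :* x := b :* (μ :* x)) refl μ b (a i) ⟩
  b * (μ * a i)    ≡⟨ cong (b *_) (a'≡μa i) ⟨
  b * a' i         ∎
  where open ≡-Reasoning

∝⇒sameIneq : ∀ {n} (p q : Vec n × ℚ) → 0ℚ < proj₂ p → 0ℚ < proj₂ q → p ∝ q → SameIneq p q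
∝⇒sameIneq (a , b) (a' , b') b>0 b'>0 a∝a' = μ , μ>0 , a'≡μa , b'≡μb
  where
  instance
    b-positive : Data.Rational.Positive b
    b-positive = Data.Rational.positive b>0
    b-nonZero : Data.Rational.NonZero b
    b-nonZero = ℚₚ.pos⇒nonZero b
  μ : ℚ
  μ = b' * 1/ b
  μ>0 : 0ℚ < μ
  μ>0 = *-pos b'>0 (ℚₚ.positive⁻¹ (1/ b) {{ℚₚ.1/pos⇒pos b}})
  b'≡μb : b' ≡ μ * b
  b'≡μb = sym (trans (ℚₚ.*-assoc b' (1/ b) b) (trans (cong (b' *_) (ℚₚ.*-inverseˡ b)) (ℚₚ.*-identityʳ b')))
  a'≡μa : ∀ i → a' i ≡ μ * a i
  a'≡μa i = *-cancelˡ-≢0 (>0⇒≢0 b>0) (begin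
    b * a' i        ≡⟨ a∝a' i ⟨
    b' * a i        ≡⟨ cong (_* a i) b'≡μb ⟩
    μ * b * a i     ≡⟨ solve 3 (λ μ b x → μ :* b :* x := b :* (μ :* x)) refl μ b (a i) ⟩
    b * (μ * a i)   ∎)
    where open ≡-Reasoning

-- With right-hand sides normalised to 1, this is the pair (a₁ / b₁ , a₂ / b₂).
combineIneq : ∀ {s t} → Vec s × ℚ → Vec t × ℚ → Vec (s ℕ.+ t) × ℚ
combineIneq (a₁ , b₁) (a₂ , b₂) = (λ i → b₂ * a₁ i) ++ (λ j → b₁ * a₂ j) , b₁ * b₂

combineIneq-∝⁻¹ : ∀ {s t} (p₁ q₁ : Vec s × ℚ) (p₂ q₂ : Vec t × ℚ) →
  proj₂ p₁ ≢ 0ℚ → proj₂ q₁ ≢ 0ℚ → proj₂ p₂ ≢ 0ℚ → proj₂ q₂ ≢ 0ℚ →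
  combineIneq p₁ p₂ ∝ combineIneq q₁ q₂ → p₁ ∝ q₁ × p₂ ∝ q₂
combineIneq-∝⁻¹ {s} {t} (a₁ , b₁) (a₁' , b₁') (a₂ , b₂) (a₂' , b₂') b₁≢0 b₁'≢0 b₂≢0 b₂'≢0 comb∝ =
  upper , lower
  where
  open ≡-Reasoning
  upper : (a₁ , b₁) ∝ (a₁' , b₁')
  upper k = *-cancelˡ-≢0 (*-≢0 b₂≢0 b₂'≢0) (begin
    b₂ * b₂' * (b₁' * a₁ k)     ≡⟨ solve 4 (λ p q r x → p :* q :* (r :* x) := r :* q :* (p :* x)) refl b₂ b₂' b₁' (a₁ k) ⟩
    b₁' * b₂' * (b₂ * a₁ k)     ≡⟨ cong (b₁' * b₂' *_) (lookup-++ˡ (λ i → b₂ * a₁ i) (λ j → b₁ * a₂ j) k) ⟨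
    b₁' * b₂' * _               ≡⟨ comb∝ (k ↑ˡ t) ⟩
    b₁ * b₂ * _                 ≡⟨ cong (b₁ * b₂ *_) (lookup-++ˡ (λ i → b₂' * a₁' i) (λ j → b₁' * a₂' j) k) ⟩
    b₁ * b₂ * (b₂' * a₁' k)     ≡⟨ solve 4 (λ p q r x → p :* q :* (r :* x) := q :* r :* (p :* x)) refl b₁ b₂ b₂' (a₁' k) ⟩
    b₂ * b₂' * (b₁ * a₁' k)     ∎)
  lower : (a₂ , b₂) ∝ (a₂' , b₂')
  lower k = *-cancelˡ-≢0 (*-≢0 b₁≢0 b₁'≢0) (begin
    b₁ * b₁' * (b₂' * a₂ k)     ≡⟨ solve 4 (λ p q r x → p :* q :* (r :* x) := q :* r :* (p :* x)) refl b₁ b₁' b₂' (a₂ k) ⟩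
    b₁' * b₂' * (b₁ * a₂ k)     ≡⟨ cong (b₁' * b₂' *_) (lookup-++ʳ (λ i → b₂ * a₁ i) (λ j → b₁ * a₂ j) k) ⟨
    b₁' * b₂' * _               ≡⟨ comb∝ (s ↑ʳ k) ⟩
    b₁ * b₂ * _                 ≡⟨ cong (b₁ * b₂ *_) (lookup-++ʳ (λ i → b₂' * a₁' i) (λ j → b₁' * a₂' j) k) ⟩
    b₁ * b₂ * (b₁' * a₂' k)     ≡⟨ solve 4 (λ p q r x → p :* q :* (r :* x) := p :* r :* (q :* x)) refl b₁ b₂ b₁' (a₂' k) ⟩
    b₁ * b₁' * (b₂ * a₂' k)     ∎)

∝-combineIneq : ∀ {s t} (a : Vec (s ℕ.+ t)) b (q₁ : Vec s × ℚ) (q₂ : Vec t × ℚ) →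
  (take s a , b) ∝ q₁ → (drop s a , b) ∝ q₂ → (a , b) ∝ combineIneq q₁ q₂
∝-combineIneq {s} {t} a b (a₁ , b₁) (a₂ , b₂) upper∝ lower∝ = splitAt-elim upper lower
  where
  open ≡-Reasoning
  upper : ∀ k → b₁ * b₂ * a (k ↑ˡ t) ≡ b * ((λ i → b₂ * a₁ i) ++ (λ j → b₁ * a₂ j)) (k ↑ˡ t)
  upper k = begin
    b₁ * b₂ * a (k ↑ˡ t)     ≡⟨ solve 3 (λ p q x → p :* q :* x := q :* (p :* x)) refl b₁ b₂ (a (k ↑ˡ t)) ⟩
    b₂ * (b₁ * a (k ↑ˡ t))   ≡⟨ cong (b₂ *_) (upper∝ k) ⟩
    b₂ * (b * a₁ k)          ≡⟨ solve 3 (λ q b x → q :* (b :* x) := b :* (q :* x)) refl b₂ b (a₁ k) ⟩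
    b * (b₂ * a₁ k)          ≡⟨ cong (b *_) (lookup-++ˡ (λ i → b₂ * a₁ i) (λ j → b₁ * a₂ j) k) ⟨
    b * _                    ∎
  lower : ∀ k → b₁ * b₂ * a (s ↑ʳ k) ≡ b * ((λ i → b₂ * a₁ i) ++ (λ j → b₁ * a₂ j)) (s ↑ʳ k)
  lower k = begin
    b₁ * b₂ * a (s ↑ʳ k)     ≡⟨ ℚₚ.*-assoc b₁ b₂ (a (s ↑ʳ k)) ⟩
    b₁ * (b₂ * a (s ↑ʳ k))   ≡⟨ cong (b₁ *_) (lower∝ k) ⟩
    b₁ * (b * a₂ k)          ≡⟨ solve 3 (λ p b x → p :* (b :* x) := b :* (p :* x)) refl b₁ b (a₂ k) ⟩
    b * (b₁ * a₂ k)          ≡⟨ cong (b *_) (lookup-++ʳ (λ i → b₂ * a₁ i) (λ j → b₁ * a₂ j) k) ⟨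
    b * _                    ∎

combineIneq-· : ∀ {s t} (a₁ : Vec s) b₁ (a₂ : Vec t) b₂ (x : Vec (s ℕ.+ t)) →
  proj₁ (combineIneq (a₁ , b₁) (a₂ , b₂)) · x ≡ b₂ * (a₁ · take s x) + b₁ * (a₂ · drop s x)
combineIneq-· {s} a₁ b₁ a₂ b₂ x = trans (++-· (λ i → b₂ * a₁ i) (λ j → b₁ * a₂ j) x)
  (cong₂ _+_ (·-*ˡ b₂ a₁ (take s x)) (·-*ˡ b₁ a₂ (drop s x)))

sameIneq⇒≡ : ∀ {m n} {L : Fin m → Vec n × ℚ} → (∀ i j → i ≢ j → ¬ SameIneq (L i) (L j)) →
  ∀ i j → SameIneq (L i) (L j) → i ≡ j
sameIneq⇒≡ distinct i j same with i Fin.≟ j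
... | yes i≡j = i≡j
... | no  i≢j = ⊥-elim (distinct i j i≢j same)

-- V = V₁ × {0} ∪ {0} × V₂ up to pointwise equality, so conv V is the free sum of
-- conv V₁ and conv V₂.
record IsFreeSum {s t} (V : Vec (s ℕ.+ t) → Set) (V₁ : Vec s → Set) (V₂ : Vec t → Set) : Set where
  field
    split  : ∀ x → V x → (V₁ (take s x) × drop s x ≗v 0ᵛ) ⊎ (V₂ (drop s x) × take s x ≗v 0ᵛ)
    upper∈ : ∀ x → V₁ x → V (x ++ 0ᵛ)
    lower∈ : ∀ y → V₂ y → V (0ᵛ ++ y)

module FreeSum {s t} {V : Vec (s ℕ.+ t) → Set} {V₁ : Vec s → Set} {V₂ : Vec t → Set}
  (free : IsFreeSum V V₁ V₂) (cross₁ : ContainsCrossPolytope V₁) (cross₂ : ContainsCrossPolytope V₂) where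

  open IsFreeSum free

  valid-take : ∀ {a b} → (∀ x → V x → a · x ≤ b) → ∀ x → V₁ x → take s a · x ≤ b
  valid-take {a} {b} valid x x∈V₁ = subst (_≤ b)
    (trans (·-++ a x 0ᵛ) (trans (cong (take s a · x +_) (·-zeroʳ (drop s a) (λ _ → refl))) (ℚₚ.+-identityʳ _)))
    (valid _ (upper∈ x x∈V₁))

  valid-drop : ∀ {a b} → (∀ x → V x → a · x ≤ b) → ∀ y → V₂ y → drop s a · y ≤ b
  valid-drop {a} {b} valid y y∈V₂ = subst (_≤ b)
    (trans (·-++ a 0ᵛ y) (trans (cong (_+ drop s a · y) (·-zeroʳ (take s a) (λ _ → refl))) (ℚₚ.+-identityˡ _)))
    (valid _ (lower∈ y y∈V₂))

  facet-rhs>0 : ∀ {a b} → IsFacetIneq V a b → 0ℚ < b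
  facet-rhs>0 {a} {b} ((i , aᵢ≢0) , valid , _) = splitAt-elim {P = λ i → a i ≢ 0ℚ → 0ℚ < b}
    (valid⇒rhs>0 {a = take s a} cross₁ (valid-take {a} valid))
    (valid⇒rhs>0 {a = drop s a} cross₂ (valid-drop {a} valid)) i aᵢ≢0

  combine-linearFacet : ∀ {a₁ b₁ a₂ b₂} → 0ℚ < b₁ → 0ℚ < b₂ →
    IsLinearFacet V₁ a₁ b₁ → IsLinearFacet V₂ a₂ b₂ →
    IsLinearFacet V (proj₁ (combineIneq (a₁ , b₁) (a₂ , b₂))) (b₁ * b₂)
  combine-linearFacet {a₁} {b₁} {a₂} {b₂} b₁>0 b₂>0 F₁ F₂ = record
    { valid       = valid
    ; vertex      = blockDiagonal F₁.vertex F₂.vertex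
    ; vertex∈V    = splitAt-elim
        (λ k → subst V (sym (lookup-++ˡ upperVertex lowerVertex k)) (upper∈ _ (F₁.vertex∈V k)))
        (λ k → subst V (sym (lookup-++ʳ upperVertex lowerVertex k)) (lower∈ _ (F₂.vertex∈V k)))
    ; tight       = splitAt-elim upper-tight lower-tight
    ; independent = independent-blockDiagonal F₁.independent F₂.independent
    }
    where
    module F₁ = IsLinearFacet F₁
    module F₂ = IsLinearFacet F₂
    open ℚₚ.≤-Reasoning
    A : Vec (s ℕ.+ t)
    A = proj₁ (combineIneq (a₁ , b₁) (a₂ , b₂))
    upperVertex : Fin s → Vec (s ℕ.+ t)
    upperVertex k = F₁.vertex k ++ 0ᵛ
    lowerVertex : Fin t → Vec (s ℕ.+ t)
    lowerVertex k = 0ᵛ ++ F₂.vertex k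

    A·++ : ∀ x y → A · (x ++ y) ≡ b₂ * (a₁ · x) + b₁ * (a₂ · y)
    A·++ x y = trans (combineIneq-· a₁ b₁ a₂ b₂ (x ++ y))
      (cong₂ (λ u v → b₂ * u + b₁ * v) (·-congʳ a₁ (lookup-++ˡ x y)) (·-congʳ a₂ (lookup-++ʳ x y)))

    valid : ∀ x → V x → A · x ≤ b₁ * b₂
    valid x x∈V with split x x∈V
    ... | inj₁ (x₁∈V₁ , lower≡0) = begin
      A · x                                          ≡⟨ combineIneq-· a₁ b₁ a₂ b₂ x ⟩
      b₂ * (a₁ · take s x) + b₁ * (a₂ · drop s x)    ≡⟨ cong (λ z → b₂ * (a₁ · take s x) + b₁ * z) (·-zeroʳ a₂ lower≡0) ⟩
      b₂ * (a₁ · take s x) + b₁ * 0ℚ                 ≡⟨ solve 3 (λ p q u → q :* u :+ p :* con 0ℚ := q :* u) refl b₁ b₂ _ ⟩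
      b₂ * (a₁ · take s x)                           ≤⟨ *-monoˡ-≤-pos b₂>0 (F₁.valid _ x₁∈V₁) ⟩
      b₂ * b₁                                        ≡⟨ ℚₚ.*-comm b₂ b₁ ⟩
      b₁ * b₂                                        ∎
    ... | inj₂ (x₂∈V₂ , upper≡0) = begin
      A · x                                          ≡⟨ combineIneq-· a₁ b₁ a₂ b₂ x ⟩
      b₂ * (a₁ · take s x) + b₁ * (a₂ · drop s x)    ≡⟨ cong (λ z → b₂ * z + b₁ * (a₂ · drop s x)) (·-zeroʳ a₁ upper≡0) ⟩
      b₂ * 0ℚ + b₁ * (a₂ · drop s x)                 ≡⟨ solve 3 (λ p q v → q :* con 0ℚ :+ p :* v := p :* v) refl b₁ b₂ _ ⟩
      b₁ * (a₂ · drop s x)                           ≤⟨ *-monoˡ-≤-pos b₁>0 (F₂.valid _ x₂∈V₂) ⟩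
      b₁ * b₂                                        ∎

    upper-tight : ∀ k → A · blockDiagonal F₁.vertex F₂.vertex (k ↑ˡ t) ≡ b₁ * b₂
    upper-tight k = begin-equality
      A · _                                   ≡⟨ cong (A ·_) (lookup-++ˡ upperVertex lowerVertex k) ⟩
      A · (F₁.vertex k ++ 0ᵛ)                 ≡⟨ A·++ (F₁.vertex k) 0ᵛ ⟩
      b₂ * (a₁ · F₁.vertex k) + b₁ * (a₂ · 0ᵛ) ≡⟨ cong₂ (λ u v → b₂ * u + b₁ * v) (F₁.tight k) (·-zeroʳ a₂ (λ _ → refl)) ⟩
      b₂ * b₁ + b₁ * 0ℚ                       ≡⟨ solve 2 (λ p q → q :* p :+ p :* con 0ℚ := p :* q) refl b₁ b₂ ⟩
      b₁ * b₂                                 ∎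

    lower-tight : ∀ k → A · blockDiagonal F₁.vertex F₂.vertex (s ↑ʳ k) ≡ b₁ * b₂
    lower-tight k = begin-equality
      A · _                                   ≡⟨ cong (A ·_) (lookup-++ʳ upperVertex lowerVertex k) ⟩
      A · (0ᵛ ++ F₂.vertex k)                 ≡⟨ A·++ 0ᵛ (F₂.vertex k) ⟩
      b₂ * (a₁ · 0ᵛ) + b₁ * (a₂ · F₂.vertex k) ≡⟨ cong₂ (λ u v → b₂ * u + b₁ * v) (·-zeroʳ a₁ (λ _ → refl)) (F₂.tight k) ⟩
      b₂ * 0ℚ + b₁ * b₂                       ≡⟨ solve 2 (λ p q → q :* con 0ℚ :+ p :* q := p :* q) refl b₁ b₂ ⟩
      b₁ * b₂                                 ∎

  split-linearFacet : ∀ {a b} → b ≢ 0ℚ → IsLinearFacet V a b →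
    IsLinearFacet V₁ (take s a) b × IsLinearFacet V₂ (drop s a) b
  split-linearFacet {a} {b} b≢0 F =
    linearFacet count-upper (take s ∘ vertex ∘ upperIndex) (valid-take {a} valid)
      (proj₁ ∘ upperIndex-A) upper-tight upper-independent ,
    linearFacet count-lower (drop s ∘ vertex ∘ lowerIndex) (valid-drop {a} valid)
      (proj₁ ∘ lowerIndex-B) lower-tight lower-independent
    where
    open IsLinearFacet F
    open BlockDecomposition vertex independent (λ j → split (vertex j) (vertex∈V j)) proj₂ proj₂
    upper-tight : ∀ k → take s a · take s (vertex (upperIndex k)) ≡ b
    upper-tight k = begin
      take s a · take s (vertex (upperIndex k))          ≡⟨ ℚₚ.+-identityʳ _ ⟨
      take s a · take s (vertex (upperIndex k)) + 0ℚ     ≡⟨ cong (take s a · take s (vertex (upperIndex k)) +_) (·-zeroʳ (drop s a) (proj₂ (upperIndex-A k))) ⟨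
      take s a · take s (vertex (upperIndex k)) + drop s a · drop s (vertex (upperIndex k))                                             ≡⟨ ·-split s a (vertex (upperIndex k)) ⟨
      a · vertex (upperIndex k)                          ≡⟨ tight (upperIndex k) ⟩
      b                                                  ∎
      where open ≡-Reasoning
    lower-tight : ∀ k → drop s a · drop s (vertex (lowerIndex k)) ≡ b
    lower-tight k = begin
      drop s a · drop s (vertex (lowerIndex k))          ≡⟨ ℚₚ.+-identityˡ _ ⟨
      0ℚ + drop s a · drop s (vertex (lowerIndex k))     ≡⟨ cong (_+ drop s a · drop s (vertex (lowerIndex k))) (·-zeroʳ (take s a) (proj₂ (lowerIndex-B k))) ⟨
      take s a · take s (vertex (lowerIndex k)) + drop s a · drop s (vertex (lowerIndex k))                                             ≡⟨ ·-split s a (vertex (lowerIndex k)) ⟨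
      a · vertex (lowerIndex k)                          ≡⟨ tight (lowerIndex k) ⟩
      b                                                  ∎
      where open ≡-Reasoning

  module _ .{{_ : NonZero s}} .{{_ : NonZero t}} where

    private instance
      s+t-nonZero : NonZero (s ℕ.+ t)
      s+t-nonZero = ℕ.>-nonZero (ℕₚ.<-≤-trans (ℕ.>-nonZero⁻¹ s) (ℕₚ.m≤m+n s t))

    combine-facet : ∀ {a₁ b₁ a₂ b₂} → IsFacetIneq V₁ a₁ b₁ → IsFacetIneq V₂ a₂ b₂ →
      IsFacetIneq V (proj₁ (combineIneq (a₁ , b₁) (a₂ , b₂))) (b₁ * b₂)
    combine-facet {b₁ = b₁} {b₂ = b₂} F₁ F₂ = linearFacet⇒facet (>0⇒≢0 (*-pos b₁>0 b₂>0))
      (combine-linearFacet b₁>0 b₂>0 (facet⇒linearFacet (>0⇒≢0 b₁>0) F₁) (facet⇒linearFacet (>0⇒≢0 b₂>0) F₂))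
      where
      b₁>0 : 0ℚ < b₁
      b₁>0 = crossPolytope-facet-rhs>0 cross₁ F₁
      b₂>0 : 0ℚ < b₂
      b₂>0 = crossPolytope-facet-rhs>0 cross₂ F₂

    split-facet : ∀ {a b} → IsFacetIneq V a b → IsFacetIneq V₁ (take s a) b × IsFacetIneq V₂ (drop s a) b
    split-facet {a} {b} F = linearFacet⇒facet b≢0 (proj₁ linearFacets) , linearFacet⇒facet b≢0 (proj₂ linearFacets)
      where
      b≢0 : b ≢ 0ℚ
      b≢0 = >0⇒≢0 (facet-rhs>0 F)
      linearFacets : IsLinearFacet V₁ (take s a) b × IsLinearFacet V₂ (drop s a) b
      linearFacets = split-linearFacet b≢0 (facet⇒linearFacet b≢0 F)

    facetNumber : ∀ {n₁ n₂} → HasFacetNumber V₁ n₁ → HasFacetNumber V₂ n₂ → HasFacetNumber V (n₁ ℕ.* n₂)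
    facetNumber {n₁} {n₂} (L₁ , facet₁ , distinct₁ , complete₁) (L₂ , facet₂ , distinct₂ , complete₂) =
      L , (λ k → combine-facet (facet₁ (proj₁ (pair k))) (facet₂ (proj₂ (pair k)))) , distinct , complete
      where
      pair : Fin (n₁ ℕ.* n₂) → Fin n₁ × Fin n₂
      pair = Fin.remQuot n₂

      L× : Fin n₁ × Fin n₂ → Vec (s ℕ.+ t) × ℚ
      L× ij = combineIneq (L₁ (proj₁ ij)) (L₂ (proj₂ ij))

      L : Fin (n₁ ℕ.* n₂) → Vec (s ℕ.+ t) × ℚ
      L k = L× (pair k)

      rhs₁>0 : ∀ i → 0ℚ < proj₂ (L₁ i)
      rhs₁>0 i = crossPolytope-facet-rhs>0 cross₁ (facet₁ i)

      rhs₂>0 : ∀ j → 0ℚ < proj₂ (L₂ j)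
      rhs₂>0 j = crossPolytope-facet-rhs>0 cross₂ (facet₂ j)

      sameIneq⇒≡× : ∀ ij ij' → SameIneq (L× ij) (L× ij') → ij ≡ ij'
      sameIneq⇒≡× (i , j) (i' , j') same = cong₂ _,_
        (sameIneq⇒≡ distinct₁ i i' (∝⇒sameIneq (L₁ i) (L₁ i') (rhs₁>0 i) (rhs₁>0 i') (proj₁ components∝)))
        (sameIneq⇒≡ distinct₂ j j' (∝⇒sameIneq (L₂ j) (L₂ j') (rhs₂>0 j) (rhs₂>0 j') (proj₂ components∝)))
        where
        components∝ : L₁ i ∝ L₁ i' × L₂ j ∝ L₂ j'
        components∝ = combineIneq-∝⁻¹ (L₁ i) (L₁ i') (L₂ j) (L₂ j')
          (>0⇒≢0 (rhs₁>0 i)) (>0⇒≢0 (rhs₁>0 i')) (>0⇒≢0 (rhs₂>0 j)) (>0⇒≢0 (rhs₂>0 j'))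
          (sameIneq⇒∝ (L× (i , j)) (L× (i' , j')) same)

      distinct : ∀ k k' → k ≢ k' → ¬ SameIneq (L k) (L k')
      distinct k k' k≢k' same = k≢k' (begin
        k                             ≡⟨ Finₚ.combine-remQuot {n₁} n₂ k ⟨
        uncurry Fin.combine (pair k)  ≡⟨ cong (uncurry Fin.combine) (sameIneq⇒≡× (pair k) (pair k') same) ⟩
        uncurry Fin.combine (pair k') ≡⟨ Finₚ.combine-remQuot {n₁} n₂ k' ⟩
        k'                            ∎)
        where open ≡-Reasoning

      complete : ∀ a b → IsFacetIneq V a b → ∃ λ k → SameIneq (a , b) (L k)
      complete a b F = Fin.combine i j ,
        subst (SameIneq (a , b) ∘ L×) (sym (Finₚ.remQuot-combine i j))
          (∝⇒sameIneq (a , b) (L× (i , j)) (facet-rhs>0 F) (*-pos (rhs₁>0 i) (rhs₂>0 j))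
            (∝-combineIneq a b (L₁ i) (L₂ j)
              (sameIneq⇒∝ (take s a , b) (L₁ i) (proj₂ match₁)) (sameIneq⇒∝ (drop s a , b) (L₂ j) (proj₂ match₂))))
        where
        match₁ : ∃ λ i → SameIneq (take s a , b) (L₁ i)
        match₁ = complete₁ (take s a) b (proj₁ (split-facet F))
        match₂ : ∃ λ j → SameIneq (drop s a , b) (L₂ j)
        match₂ = complete₂ (drop s a) b (proj₂ (split-facet F))
        i : Fin n₁
        i = proj₁ match₁
        j : Fin n₂
        j = proj₁ match₂

-- Ordinal sums of posets

singleton-true : ∀ {n} (i j : Fin n) → singleton i j ≡ true → i ≡ j
singleton-true i j eq with i Fin.≟ j
singleton-true i j refl | yes i≡j = i≡j

singleton-antichain : ∀ {n} (R : Rel n) i → IsAntichain R (singleton i)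
singleton-antichain R i j k ij kk j≢k _ = j≢k (trans (sym (singleton-true i j ij)) (singleton-true i k kk))

ΓGen-crossPolytope : ∀ {n} (P Q : Rel n) → ContainsCrossPolytope (ΓGen P Q)
ΓGen-crossPolytope P Q i =
  inj₁ (singleton i , singleton-antichain P i , λ _ → refl) ,
  inj₂ (singleton i , singleton-antichain Q i , λ _ → refl)

-- With f = id or f = -_ these are the two halves of ΓGen.
AntichainPoint : ∀ {n} → (ℚ → ℚ) → Rel n → Vec n → Set
AntichainPoint f R x = ∃ λ A → IsAntichain R A × x ≗v (λ i → f (ρ A i))

fρ-false : ∀ {n} (f : ℚ → ℚ) → f 0ℚ ≡ 0ℚ → (A : Fin n → Bool) {i : Fin n} → A i ≡ false → f (ρ A i) ≡ 0ℚ
fρ-false f f0≡0 A Ai≡false = trans (cong (f ∘ (if_then 1ℚ else 0ℚ)) Ai≡false) f0≡0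

↑ˡ≢↑ʳ : ∀ {s t} (i : Fin s) (j : Fin t) → i ↑ˡ t ≢ s ↑ʳ j
↑ˡ≢↑ʳ {s} {t} i j eq with trans (sym (Finₚ.splitAt-↑ˡ s i t)) (trans (cong (splitAt s) eq) (Finₚ.splitAt-↑ʳ s t j))
... | ()

module _ {s t} (P : Rel s) (P' : Rel t) where

  antichain-⊕ : ∀ A → IsAntichain (P ⊕ P') A →
    (IsAntichain P (take s A) × ∀ j → drop s A j ≡ false) ⊎
    (IsAntichain P' (drop s A) × ∀ i → take s A i ≡ false)
  antichain-⊕ A anti with Finₚ.any? (λ i → A (i ↑ˡ t) Boolₚ.≟ true)
  ... | yes (i₀ , Ai₀) = inj₁ (upper-antichain , lower-empty)
    where
    upper-antichain : IsAntichain P (take s A)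
    upper-antichain i j Ai Aj i≢j Pij = anti (i ↑ˡ t) (j ↑ˡ t) Ai Aj (i≢j ∘ Finₚ.↑ˡ-injective t i j)
      (subst₂ (ordSum⊎ P P') (sym (Finₚ.splitAt-↑ˡ s i t)) (sym (Finₚ.splitAt-↑ˡ s j t)) Pij)
    lower-empty : ∀ j → A (s ↑ʳ j) ≡ false
    lower-empty j = Boolₚ.¬-not λ Aj → anti (i₀ ↑ˡ t) (s ↑ʳ j) Ai₀ Aj (↑ˡ≢↑ʳ i₀ j)
      (subst₂ (ordSum⊎ P P') (sym (Finₚ.splitAt-↑ˡ s i₀ t)) (sym (Finₚ.splitAt-↑ʳ s t j)) _)
  ... | no upper-empty = inj₂ (lower-antichain , λ i → Boolₚ.¬-not (upper-empty ∘ (i ,_)))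
    where
    lower-antichain : IsAntichain P' (drop s A)
    lower-antichain i j Ai Aj i≢j P'ij = anti (s ↑ʳ i) (s ↑ʳ j) Ai Aj (i≢j ∘ Finₚ.↑ʳ-injective s i j)
      (subst₂ (ordSum⊎ P P') (sym (Finₚ.splitAt-↑ʳ s t i)) (sym (Finₚ.splitAt-↑ʳ s t j)) P'ij)

  antichain-++ˡ : ∀ A → IsAntichain P A → IsAntichain (P ⊕ P') (A ++ λ _ → false)
  antichain-++ˡ A anti i j Ai Aj i≢j with splitAt s i in eqᵢ | splitAt s j in eqⱼ
  ... | inj₁ i' | inj₁ j' = anti i' j' Ai Aj
    (λ i'≡j' → i≢j (trans (sym (Finₚ.splitAt⁻¹-↑ˡ eqᵢ)) (trans (cong (_↑ˡ t) i'≡j') (Finₚ.splitAt⁻¹-↑ˡ eqⱼ))))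

  antichain-++ʳ : ∀ A → IsAntichain P' A → IsAntichain (P ⊕ P') ((λ _ → false) ++ A)
  antichain-++ʳ A anti i j Ai Aj i≢j with splitAt s i in eqᵢ | splitAt s j in eqⱼ
  ... | inj₂ i' | inj₂ j' = anti i' j' Ai Aj
    (λ i'≡j' → i≢j (trans (sym (Finₚ.splitAt⁻¹-↑ʳ eqᵢ)) (trans (cong (s ↑ʳ_) i'≡j') (Finₚ.splitAt⁻¹-↑ʳ eqⱼ))))

  antichainPoint-⊕ : ∀ f → f 0ℚ ≡ 0ℚ → ∀ {x} → AntichainPoint f (P ⊕ P') x →
    (AntichainPoint f P (take s x) × drop s x ≗v 0ᵛ) ⊎ (AntichainPoint f P' (drop s x) × take s x ≗v 0ᵛ)
  antichainPoint-⊕ f f0≡0 (A , anti , x≗fρA) with antichain-⊕ A anti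
  ... | inj₁ (upper-antichain , lower-empty) =
    inj₁ ((take s A , upper-antichain , x≗fρA ∘ (_↑ˡ t)) ,
          λ j → trans (x≗fρA (s ↑ʳ j)) (fρ-false f f0≡0 A (lower-empty j)))
  ... | inj₂ (lower-antichain , upper-empty) =
    inj₂ ((drop s A , lower-antichain , x≗fρA ∘ (s ↑ʳ_)) ,
          λ i → trans (x≗fρA (i ↑ˡ t)) (fρ-false f f0≡0 A (upper-empty i)))

  antichainPoint-++ˡ : ∀ f → f 0ℚ ≡ 0ℚ → ∀ {x} → AntichainPoint f P x → AntichainPoint f (P ⊕ P') (x ++ 0ᵛ)
  antichainPoint-++ˡ f f0≡0 {x} (A , anti , x≗fρA) = A ++ (λ _ → false) , antichain-++ˡ A anti , splitAt-elim
    (λ i → trans (lookup-++ˡ x 0ᵛ i) (trans (x≗fρA i) (cong (f ∘ (if_then 1ℚ else 0ℚ)) (sym (lookup-++ˡ A (λ (_ : Fin t) → false) i)))))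
    (λ j → trans (lookup-++ʳ x 0ᵛ j) (sym (fρ-false f f0≡0 (A ++ λ _ → false) (lookup-++ʳ A (λ (_ : Fin t) → false) j))))

  antichainPoint-++ʳ : ∀ f → f 0ℚ ≡ 0ℚ → ∀ {y} → AntichainPoint f P' y → AntichainPoint f (P ⊕ P') (0ᵛ ++ y)
  antichainPoint-++ʳ f f0≡0 {y} (A , anti , y≗fρA) = (λ _ → false) ++ A , antichain-++ʳ A anti , splitAt-elim
    (λ i → trans (lookup-++ˡ 0ᵛ y i) (sym (fρ-false f f0≡0 ((λ (_ : Fin s) → false) ++ A) (lookup-++ˡ (λ (_ : Fin s) → false) A i))))
    (λ j → trans (lookup-++ʳ (0ᵛ {s}) y j) (trans (y≗fρA j) (cong (f ∘ (if_then 1ℚ else 0ℚ)) (sym (lookup-++ʳ (λ (_ : Fin s) → false) A j)))))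

ΓGen-⊕-isFreeSum : ∀ {s t} (P₁ Q₁ : Rel s) (P₂ Q₂ : Rel t) →
  IsFreeSum (ΓGen (P₁ ⊕ P₂) (Q₁ ⊕ Q₂)) (ΓGen P₁ Q₁) (ΓGen P₂ Q₂)
ΓGen-⊕-isFreeSum P₁ Q₁ P₂ Q₂ = record
  { split  = λ where
      x (inj₁ p) → Sum.map (map₁ inj₁) (map₁ inj₁) (antichainPoint-⊕ P₁ P₂ (λ q → q) refl p)
      x (inj₂ q) → Sum.map (map₁ inj₂) (map₁ inj₂) (antichainPoint-⊕ Q₁ Q₂ -_ refl q)
  ; upper∈ = λ where
      x (inj₁ p) → inj₁ (antichainPoint-++ˡ P₁ P₂ (λ q → q) refl p)
      x (inj₂ q) → inj₂ (antichainPoint-++ˡ Q₁ Q₂ -_ refl q)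
  ; lower∈ = λ where
      y (inj₁ p) → inj₁ (antichainPoint-++ʳ P₁ P₂ (λ q → q) refl p)
      y (inj₂ q) → inj₂ (antichainPoint-++ʳ Q₁ Q₂ -_ refl q)
  }

*-^-distrib : ∀ m n k → (m ℕ.* n) ^ k ≡ m ^ k ℕ.* n ^ k
*-^-distrib m n zero    = refl
*-^-distrib m n (suc k) = trans (cong (m ℕ.* n ℕ.*_) (*-^-distrib m n k)) (interchange m n (m ^ k) (n ^ k))

*-^-≤-^-+ : ∀ m n c s t k → m ^ k ℕ.≤ c ^ s → n ^ k ℕ.≤ c ^ t → (m ℕ.* n) ^ k ℕ.≤ c ^ (s ℕ.+ t)
*-^-≤-^-+ m n c s t k mᵏ≤cˢ nᵏ≤cᵗ = begin
  (m ℕ.* n) ^ k        ≡⟨ *-^-distrib m n k ⟩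
  m ^ k ℕ.* n ^ k      ≤⟨ ℕₚ.*-mono-≤ mᵏ≤cˢ nᵏ≤cᵗ ⟩
  c ^ s ℕ.* c ^ t      ≡⟨ ℕₚ.^-distribˡ-+-* c s t ⟨
  c ^ (s ℕ.+ t)        ∎
  where open ℕₚ.≤-Reasoning

proposition2p4 : (s t : ℕ) → .{{_ : NonZero s}} → .{{_ : NonZero t}} →
  (P₁ Q₁ : Rel s) (P₂ Q₂ : Rel t) →
  IsPartialOrder _≡_ P₁ → IsPartialOrder _≡_ Q₁ →
  IsPartialOrder _≡_ P₂ → IsPartialOrder _≡_ Q₂ →
  (n₁ n₂ : ℕ) →
  HasFacetNumber (ΓGen P₁ Q₁) n₁ →
  HasFacetNumber (ΓGen P₂ Q₂) n₂ →
  HasFacetNumber (ΓGen (P₁ ⊕ P₂) (Q₁ ⊕ Q₂)) (n₁ ℕ.* n₂) ×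
  (n₁ ^ 2 ℕ.≤ 6 ^ s → n₂ ^ 2 ℕ.≤ 6 ^ t → (n₁ ℕ.* n₂) ^ 2 ℕ.≤ 6 ^ (s ℕ.+ t))
proposition2p4 s t P₁ Q₁ P₂ Q₂ _ _ _ _ n₁ n₂ N₁ N₂ =
  facetNumber N₁ N₂ , *-^-≤-^-+ n₁ n₂ 6 s t 2
  where
  open FreeSum (ΓGen-⊕-isFreeSum P₁ Q₁ P₂ Q₂) (ΓGen-crossPolytope P₁ Q₁) (ΓGen-crossPolytope P₂ Q₂)
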